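{- Let $n\ge 1$ and $F\colon \mathbb{F}_{2^n}\to\mathbb{F}_{2^n}$. (a) Suppose there is no non-zero linear map $L\colon\mathbb{F}_{2^n}\to\mathbb{F}_{2^n}$ such that $x\mapsto F(x)+L(x)$ is a permutation of $\mathbb{F}_{2^n}$. Then every permutation of $\mathbb{F}_{2^n}$ that is EA-equivalent to $F$ is affine equivalent to $F$. In particular, if such an $F$ is not bijective, then there is no permutation of $\mathbb{F}_{2^n}$ that is EA-equivalent to $F$. (b) Suppose there are no non-zero linear maps $L_1,L_2\colon\mathbb{F}_{2^n}\to\mathbb{F}_{2^n}$ such that $x\mapsto L_1(F(x))+L_2(x)$ is a permutation of $\mathbb{F}_{2^n}$. Then every function $\mathbb{F}_{2^n}\to\mathbb{F}_{2^n}$ that is CCZ-equivalent to $F$ is EA-equivalent to $F$ or to $F^{ -1}$ (the latter only when $F$ is bijective). Moreover, every permutation of $\mathbb{F}_{2^n}$ that is CCZ-equivalent to $F$ is affine equivalent to $F$ or to $F^{ -1}$.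
   Context: "Linear" means $\mathbb{F}_2$-linear; a map is affine if it is the sum of a linear map and a constant. Two functions $F_1,F_2\colon\mathbb{F}_{2^n}\to\mathbb{F}_{2^n}$ are EA-equivalent if there are affine permutations $A_1,A_2$ of $\mathbb{F}_{2^n}$ and an affine map $A_3\colon\mathbb{F}_{2^n}\to\mathbb{F}_{2^n}$ with $A_1(F_1(A_2(x)))+A_3(x)=F_2(x)$ for all $x$; they are affine equivalent if this can be achieved with $A_3=0$. With the graph $G_F=\{(x,F(x)):x\in\mathbb{F}_{2^n}\}$, $F_1$ and $F_2$ are CCZ-equivalent if there exist linear $\alpha,\beta,\gamma,\delta\colon\mathbb{F}_{2^n}\to\mathbb{F}_{2^n}$ and $a,b\in\mathbb{F}_{2^n}$ such that $\mathcal L(x,y)=(\alpha(x)+\beta(y),\gamma(x)+\delta(y))$ is a bijection of $\mathbb{F}_{2^n}^2$ and $\mathcal L(G_{F_1})+(a,b)=G_{F_2}$. (EA-equivalence corresponds to such an $\mathcal L$ with $\beta=0$, affine equivalence to $\beta=\gamma=0$.) -}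

module Defs where

open import Data.Nat using (ℕ)
open import Data.Bool using (Bool; false; _xor_)
open import Data.Vec using (Vec; zipWith; replicate)
open import Data.Product using (Σ; _×_; _,_; ∃)
open import Relation.Nullary using (¬_)
open import Relation.Binary.PropositionalEquality using (_≡_)
import Function.Definitions as FD

-- The additive group of F_{2^n}, viewed as an n-dimensional F_2-vector space
-- (via a fixed F_2-basis).  Only F_2-linear structure enters the statement.
V : ℕ → Set
V n = Vec Bool n

infixl 6 _⊕_
_⊕_ : ∀ {n} → V n → V n → V n
_⊕_ = zipWith _xor_

𝟎 : ∀ {n} → V n
𝟎 {n} = replicate n false

Bijective : {A B : Set} → (A → B) → Set
Bijective f = FD.Bijective _≡_ _≡_ f

-- F_2-linear map (over F_2, additivity is exactly linearity)
IsLinear : ∀ {n m} → (V n → V m) → Set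
IsLinear L = ∀ x y → L (x ⊕ y) ≡ L x ⊕ L y

IsZeroMap : ∀ {n m} → (V n → V m) → Set
IsZeroMap L = ∀ x → L x ≡ 𝟎

IsAffine : ∀ {n} → (V n → V n) → Set
IsAffine {n} A = Σ (V n → V n) λ L → Σ (V n) λ c → IsLinear L × (∀ x → A x ≡ L x ⊕ c)

IsAffinePerm : ∀ {n} → (V n → V n) → Set
IsAffinePerm A = IsAffine A × Bijective A

EAEquiv : ∀ {n} → (V n → V n) → (V n → V n) → Set
EAEquiv {n} F₁ F₂ =
  Σ (V n → V n) λ A₁ → Σ (V n → V n) λ A₂ → Σ (V n → V n) λ A₃ →
    IsAffinePerm A₁ × IsAffinePerm A₂ × IsAffine A₃ ×
    (∀ x → A₁ (F₁ (A₂ x)) ⊕ A₃ x ≡ F₂ x)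

AffEquiv : ∀ {n} → (V n → V n) → (V n → V n) → Set
AffEquiv {n} F₁ F₂ =
  Σ (V n → V n) λ A₁ → Σ (V n → V n) λ A₂ →
    IsAffinePerm A₁ × IsAffinePerm A₂ × (∀ x → A₁ (F₁ (A₂ x)) ≡ F₂ x)

𝓛 : ∀ {n} → (α β γ δ : V n → V n) → V n × V n → V n × V n
𝓛 α β γ δ (x , y) = (α x ⊕ β y , γ x ⊕ δ y)

Graph : ∀ {n} → (V n → V n) → V n × V n → Set
Graph {n} F p = Σ (V n) λ x → p ≡ (x , F x)

CCZEquiv : ∀ {n} → (V n → V n) → (V n → V n) → Set
CCZEquiv {n} F₁ F₂ =
  Σ (V n → V n) λ α → Σ (V n → V n) λ β → Σ (V n → V n) λ γ → Σ (V n → V n) λ δ →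
  Σ (V n) λ a → Σ (V n) λ b →
    IsLinear α × IsLinear β × IsLinear γ × IsLinear δ ×
    Bijective (𝓛 α β γ δ) ×
    (∀ p → Graph F₁ p → Graph F₂ (shift (𝓛 α β γ δ p) a b)) ×
    (∀ q → Graph F₂ q → Σ (V n × V n) λ p → Graph F₁ p × (shift (𝓛 α β γ δ p) a b ≡ q))
  where
  shift : V n × V n → V n → V n → V n × V n
  shift (u , v) a b = (u ⊕ a , v ⊕ b)

IsInverse : ∀ {n} → (V n → V n) → (V n → V n) → Set
IsInverse G F = (∀ x → G (F x) ≡ x) × (∀ y → F (G y) ≡ y)

module Submission where

-- If P = A₁ ∘ H ∘ A₂ + A₃ is a permutation, with linear parts
-- L₁, L₂, L₃ of the affine maps, then H + L₁⁻¹ ∘ L₃ ∘ L₂⁻¹ is a permutation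
-- (it is P composed with affine permutations).  When no non-zero linear map
-- can be added to H to give a permutation, L₃ must vanish, A₃ is constant and
-- can be absorbed into A₁: the equivalence is affine.
--
-- A CCZ-equivalence maps the graph of F onto that of G, so with
-- φ x = α x + β (F x) + a we get G (φ x) = γ x + δ (F x) + b, and φ is a
-- permutation.  Since x ↦ β (F x) + α x is then a permutation, the hypothesis
-- forces β = 0 or α = 0.  If β = 0 the relation reads G (α x + a) = ...,
-- which is an EA-equivalence of F and G.  If α = 0 then F is injective, hence
-- (by finiteness) a permutation, and exchanging the two coordinates turns the
-- situation into the case β = 0 for F⁻¹.  Permutations are then handled by
-- part (a), whose hypothesis holds for F and for F⁻¹.

open import Defs
open import Data.Nat using (ℕ; suc; _^_; _≤_)
open import Data.Nat.Properties using (n<1+n)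
open import Data.Bool using (true)
open import Data.Bool.Properties using (xor-comm; xor-assoc; xor-identityˡ; xor-identityʳ; xor-same)
import Data.Bool.Properties as Bool
open import Data.Vec using ([]; _∷_)
open import Data.Vec.Properties
  using (zipWith-comm; zipWith-assoc; zipWith-identityˡ; zipWith-identityʳ; ≡-dec)
open import Data.Vec.Recursive using (lift↔; Fin[m^n]↔Fin[m]^n)
open import Data.Vec.Recursive.Properties using (↔Vec)
open import Data.Fin using (Fin; punchOut; _<_)
open import Data.Fin.Properties
  using (2↔Bool; _≟_; any?; all?; pigeonhole; punchOut-injective; <-irrefl)
open import Data.Product using (Σ; _×_; _,_; proj₁; proj₂; ∃₂; swap)
open import Data.Product.Properties using (,-injective)
open import Data.Sum using (_⊎_; inj₁; inj₂)
open import Data.Empty using (⊥-elim)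
open import Function using (_∘_; id; _↔_; Inverse)
open import Function.Definitions using (Injective; StrictlySurjective)
open import Function.Properties.Inverse using (↔-sym; ↔-trans)
open import Function.Consequences.Propositional using (strictlySurjective⇒surjective)
import Function.Construct.Composition as Composition
import Function.Construct.Symmetry as Symmetry
open import Algebra.Bundles using (CommutativeSemigroup)
import Algebra.Properties.CommutativeSemigroup as CommutativeSemigroupProperties
open import Relation.Nullary using (¬_; Dec; yes; no)
open import Relation.Nullary.Decidable using (map′; decidable-stable)
open import Relation.Binary.PropositionalEquality

private variable
  n : ℕ
  A B C : Set

⊕-comm : (x y : V n) → x ⊕ y ≡ y ⊕ x
⊕-comm = zipWith-comm xor-comm

⊕-assoc : (x y z : V n) → (x ⊕ y) ⊕ z ≡ x ⊕ (y ⊕ z)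
⊕-assoc = zipWith-assoc xor-assoc

⊕-identityʳ : (x : V n) → x ⊕ 𝟎 ≡ x
⊕-identityʳ = zipWith-identityʳ xor-identityʳ

⊕-identityˡ : (x : V n) → 𝟎 ⊕ x ≡ x
⊕-identityˡ = zipWith-identityˡ xor-identityˡ

⊕-self : (x : V n) → x ⊕ x ≡ 𝟎
⊕-self []      = refl
⊕-self (b ∷ x) = cong₂ _∷_ (xor-same b) (⊕-self x)

⊕-cancel : (x c : V n) → (x ⊕ c) ⊕ c ≡ x
⊕-cancel x c = begin
  (x ⊕ c) ⊕ c  ≡⟨ ⊕-assoc x c c ⟩
  x ⊕ (c ⊕ c)  ≡⟨ cong (x ⊕_) (⊕-self c) ⟩
  x ⊕ 𝟎        ≡⟨ ⊕-identityʳ x ⟩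
  x            ∎
  where open ≡-Reasoning

⊕-injectiveʳ : (c : V n) → Injective _≡_ _≡_ (_⊕ c)
⊕-injectiveʳ c {x} {y} e = begin
  x            ≡⟨ ⊕-cancel x c ⟨
  (x ⊕ c) ⊕ c  ≡⟨ cong (_⊕ c) e ⟩
  (y ⊕ c) ⊕ c  ≡⟨ ⊕-cancel y c ⟩
  y            ∎
  where open ≡-Reasoning

⊕-commutativeSemigroup : ℕ → CommutativeSemigroup _ _
⊕-commutativeSemigroup n = record
  { Carrier = V n
  ; _≈_     = _≡_
  ; _∙_     = _⊕_
  ; isCommutativeSemigroup = record
    { isSemigroup = record
      { isMagma = record { isEquivalence = isEquivalence ; ∙-cong = cong₂ _⊕_ }
      ; assoc   = ⊕-assoc }
    ; comm = ⊕-comm } }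

module ⊕ {n : ℕ} = CommutativeSemigroupProperties (⊕-commutativeSemigroup n)

bijective : {f : A → B} → Injective _≡_ _≡_ f → StrictlySurjective _≡_ f → Bijective f
bijective inj surj = inj , strictlySurjective⇒surjective surj

inverse : {f : A → B} → Bijective f → B → A
inverse (_ , surj) y = proj₁ (surj y)

inverseʳ : {f : A → B} (b : Bijective f) → ∀ y → f (inverse b y) ≡ y
inverseʳ (_ , surj) y = proj₂ (surj y) refl

inverseˡ : {f : A → B} (b : Bijective f) → ∀ x → inverse b (f x) ≡ x
inverseˡ b x = proj₁ b (inverseʳ b _)

inverse-bijective : {f : A → B} (b : Bijective f) → Bijective (inverse b)
inverse-bijective {f = f} b = Symmetry.bijective b refl sym trans (cong f)

∘-bijective : {f : B → C} {g : A → B} → Bijective f → Bijective g → Bijective (f ∘ g)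
∘-bijective bf bg = Composition.bijective _≡_ _≡_ _≡_ bg bf

bijective-≗ : {f g : A → B} → Bijective f → (∀ x → f x ≡ g x) → Bijective g
bijective-≗ {f = f} {g} b f≗g = bijective
  (λ {x} {y} e → proj₁ b (trans (f≗g x) (trans e (sym (f≗g y)))))
  (λ y → inverse b y , trans (sym (f≗g _)) (inverseʳ b y))

inverse⇒bijective : {F Fi : V n → V n} → IsInverse Fi F → Bijective Fi
inverse⇒bijective {F = F} {Fi} (left , right) =
  bijective (λ {x} {y} e → trans (sym (right x)) (trans (cong F e) (right y)))
            (λ x → F x , left x)

translation-bijective : (c : V n) → Bijective (_⊕ c)
translation-bijective c = bijective (⊕-injectiveʳ c) (λ y → y ⊕ c , ⊕-cancel y c)

V↔Fin : V n ↔ Fin (2 ^ n)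
V↔Fin {n} = ↔-sym (↔-trans (Fin[m^n]↔Fin[m]^n 2 n) (↔-trans (lift↔ n 2↔Bool) (↔Vec n)))

-- an endomap of Fin (1 + m) missing a value factors through Fin m, so by the
-- pigeonhole principle it identifies two points
missing-value⇒collision : ∀ {m} (f : Fin (suc m) → Fin (suc m)) y → (∀ x → f x ≢ y) →
                          ∃₂ λ i j → i < j × f i ≡ f j
missing-value⇒collision {m} f y miss =
  let avoids : ∀ i → y ≢ f i
      avoids i e = miss i (sym e)
      (i , j , i<j , same) = pigeonhole (n<1+n m) (λ i → punchOut (avoids i))
  in i , j , i<j , punchOut-injective (avoids i) (avoids j) same

fin-injective⇒surjective : ∀ {m} {f : Fin m → Fin m} →
                           Injective _≡_ _≡_ f → StrictlySurjective _≡_ f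
fin-injective⇒surjective {suc m} {f} inj y with any? (λ x → f x ≟ y)
... | yes hit = hit
... | no miss with i , j , i<j , same ← missing-value⇒collision f y (λ x e → miss (x , e))
  = ⊥-elim (<-irrefl (inj same) i<j)

-- an injective endomap of V n is a permutation (transported from Fin (2 ^ n));
-- this is the finiteness used to invert F and the blocks of a CCZ map
injective⇒bijective : {f : V n → V n} → Injective _≡_ _≡_ f → Bijective f
injective⇒bijective {n} {f} inj = bijective inj surj
  where
  open Inverse (V↔Fin {n})
  onFin : Fin (2 ^ n) → Fin (2 ^ n)
  onFin i = to (f (from i))
  from-injective : Injective _≡_ _≡_ from
  from-injective {i} {j} e = trans (sym (strictlyInverseˡ i)) (trans (cong to e) (strictlyInverseˡ j))
  to-injective : Injective _≡_ _≡_ to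
  to-injective {x} {y} e = trans (sym (strictlyInverseʳ x)) (trans (cong from e) (strictlyInverseʳ y))
  onFin-injective : Injective _≡_ _≡_ onFin
  onFin-injective e = from-injective (inj (to-injective e))
  surj : StrictlySurjective _≡_ f
  surj y with i , e ← fin-injective⇒surjective onFin-injective (to y)
    = from i , to-injective e

all-V? : {P : V n → Set} → (∀ v → Dec (P v)) → Dec (∀ v → P v)
all-V? {n} {P} P? = map′ (λ h v → subst P (strictlyInverseʳ v) (h (to v))) (λ h i → h (from i))
                         (all? (λ i → P? (from i)))
  where open Inverse (V↔Fin {n})

isZeroMap? : (L : V n → V n) → Dec (IsZeroMap L)
isZeroMap? L = all-V? (λ v → ≡-dec Bool._≟_ (L v) 𝟎)

zero-stable : (L : V n → V n) → ¬ ¬ IsZeroMap L → IsZeroMap L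
zero-stable L = decidable-stable (isZeroMap? L)

linear-𝟎 : {L : V n → V n} → IsLinear L → L 𝟎 ≡ 𝟎
linear-𝟎 {L = L} lin = begin
  L 𝟎              ≡⟨ cong L (⊕-self 𝟎) ⟨
  L (𝟎 ⊕ 𝟎)        ≡⟨ lin 𝟎 𝟎 ⟩
  L 𝟎 ⊕ L 𝟎        ≡⟨ ⊕-self (L 𝟎) ⟩
  𝟎                ∎
  where open ≡-Reasoning

linear-∘ : {L M : V n → V n} → IsLinear L → IsLinear M → IsLinear (L ∘ M)
linear-∘ {L = L} linL linM x y = trans (cong L (linM x y)) (linL _ _)

linear-inverse : {L : V n → V n} (b : Bijective L) → IsLinear L → IsLinear (inverse b)
linear-inverse {L = L} b lin x y = proj₁ b (begin
  L (inverse b (x ⊕ y))               ≡⟨ inverseʳ b (x ⊕ y) ⟩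
  x ⊕ y                               ≡⟨ cong₂ _⊕_ (inverseʳ b x) (inverseʳ b y) ⟨
  L (inverse b x) ⊕ L (inverse b y)   ≡⟨ lin _ _ ⟨
  L (inverse b x ⊕ inverse b y)       ∎)
  where open ≡-Reasoning

id-nonzero : 1 ≤ n → ¬ IsZeroMap {n} id
id-nonzero {suc _} _ zero with zero (true ∷ 𝟎)
... | ()

affine-permutation : {L : V n → V n} → IsLinear L → Bijective L → (c : V n) →
                     (A : V n → V n) → (∀ x → A x ≡ L x ⊕ c) → IsAffinePerm A
affine-permutation lin bij c A A≗ =
  (_ , c , lin , A≗) , bijective-≗ (∘-bijective (translation-bijective c) bij) (λ x → sym (A≗ x))

translated-linear : {L : V n → V n} → IsLinear L → (c : V n) → IsAffine (λ y → L (y ⊕ c))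
translated-linear lin c = _ , _ , lin , λ y → lin y c

linear-part-bijective : {A : V n → V n} (ap : IsAffinePerm A) → Bijective (proj₁ (proj₁ ap))
linear-part-bijective ((L , c , lin , A≗) , bij) =
  bijective-≗ (∘-bijective (translation-bijective c) bij)
              (λ x → trans (cong (_⊕ c) (A≗ x)) (⊕-cancel _ c))

shifted-affine-permutation : {A : V n → V n} → IsAffinePerm A → (c : V n) →
                             IsAffinePerm (λ z → A z ⊕ c)
shifted-affine-permutation ap@((L , c₁ , lin , A≗) , _) c =
  affine-permutation lin (linear-part-bijective ap) (c₁ ⊕ c) _
                     (λ z → trans (cong (_⊕ c) (A≗ z)) (⊕-assoc _ _ _))

NoLinearAddend : (H : V n → V n) → Set
NoLinearAddend {n} H =
  ¬ Σ (V n → V n) λ L → IsLinear L × ¬ IsZeroMap L × Bijective (λ x → H x ⊕ L x)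

-- If P x = A₁ (H (A₂ x)) + A₃ x is a permutation, where A₁ = L₁ + c₁ and
-- A₂ = L₂ + c₂ are affine permutations and L₃ + c₃ = A₃, then
-- H + L₁⁻¹ ∘ L₃ ∘ L₂⁻¹ is a permutation: it equals L₁⁻¹ ∘ (P ∘ A₂⁻¹ + d).
ea-addend-bijective :
  {H P A₁ A₂ L₁ L₂ L₃ : V n → V n} {c₁ c₂ c₃ : V n} →
  IsLinear L₁ → (b₁ : Bijective L₁) → (∀ z → A₁ z ≡ L₁ z ⊕ c₁) →
  IsLinear L₂ → (b₂ : Bijective L₂) → (∀ x → A₂ x ≡ L₂ x ⊕ c₂) →
  IsLinear L₃ → Bijective P → (∀ x → A₁ (H (A₂ x)) ⊕ (L₃ x ⊕ c₃) ≡ P x) →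
  Bijective (λ y → H y ⊕ inverse b₁ (L₃ (inverse b₂ y)))
ea-addend-bijective {n} {H} {P} {A₁} {A₂} {L₁} {L₂} {L₃} {c₁} {c₂} {c₃}
                    lin₁ b₁ A₁≗ lin₂ b₂ A₂≗ lin₃ bP P≗ =
  bijective-≗ (∘-bijective (inverse-bijective b₁)
                 (∘-bijective (translation-bijective d) (∘-bijective bP
                    (∘-bijective (inverse-bijective b₂) (translation-bijective c₂)))))
              reduce
  where
  M N : V n → V n
  M = inverse b₁
  N = inverse b₂
  d : V n
  d = c₁ ⊕ (L₃ (N c₂) ⊕ c₃)
  A₂∘N : ∀ y → A₂ (N (y ⊕ c₂)) ≡ y
  A₂∘N y = trans (A₂≗ _) (trans (cong (_⊕ c₂) (inverseʳ b₂ _)) (⊕-cancel y c₂))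
  P∘A₂⁻¹ : ∀ y → P (N (y ⊕ c₂)) ⊕ d ≡ L₁ (H y) ⊕ L₃ (N y)
  P∘A₂⁻¹ y = begin
    P (N (y ⊕ c₂)) ⊕ d
      ≡⟨ cong (_⊕ d) (P≗ _) ⟨
    A₁ (H (A₂ (N (y ⊕ c₂)))) ⊕ (L₃ (N (y ⊕ c₂)) ⊕ c₃) ⊕ d
      ≡⟨ cong₂ (λ u v → u ⊕ (v ⊕ c₃) ⊕ d) (trans (cong (A₁ ∘ H) (A₂∘N y)) (A₁≗ (H y)))
                                          (trans (cong L₃ (linear-inverse b₂ lin₂ y c₂)) (lin₃ _ _)) ⟩
    (L₁ (H y) ⊕ c₁) ⊕ ((L₃ (N y) ⊕ L₃ (N c₂)) ⊕ c₃) ⊕ d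
      ≡⟨ cong (λ t → (L₁ (H y) ⊕ c₁) ⊕ t ⊕ d) (⊕-assoc _ _ _) ⟩
    (L₁ (H y) ⊕ c₁) ⊕ (L₃ (N y) ⊕ (L₃ (N c₂) ⊕ c₃)) ⊕ d
      ≡⟨ cong (_⊕ d) (⊕.interchange _ _ _ _) ⟩
    (L₁ (H y) ⊕ L₃ (N y)) ⊕ d ⊕ d
      ≡⟨ ⊕-cancel _ d ⟩
    L₁ (H y) ⊕ L₃ (N y)
      ∎
    where open ≡-Reasoning
  reduce : ∀ y → M (P (N (y ⊕ c₂)) ⊕ d) ≡ H y ⊕ M (L₃ (N y))
  reduce y = trans (cong M (P∘A₂⁻¹ y))
                   (trans (linear-inverse b₁ lin₁ _ _) (cong (_⊕ M (L₃ (N y))) (inverseˡ b₁ (H y))))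

-- Part (a), first claim: every permutation EA-equivalent to H is affine
-- equivalent to it, because the linear part of A₃ must vanish.
ea⇒affine : {H P : V n → V n} → NoLinearAddend H → Bijective P → EAEquiv H P → AffEquiv H P
ea⇒affine {n} {H} {P} noAddend bP
  (A₁ , A₂ , A₃ , ap₁@((L₁ , c₁ , lin₁ , A₁≗) , _) , ap₂@((L₂ , c₂ , lin₂ , A₂≗) , _) ,
   (L₃ , c₃ , lin₃ , A₃≗) , P≗) =
  (λ z → A₁ z ⊕ c₃) , A₂ , shifted-affine-permutation ap₁ c₃ , ap₂ , affine
  where
  b₁ : Bijective L₁
  b₁ = linear-part-bijective ap₁
  b₂ : Bijective L₂
  b₂ = linear-part-bijective ap₂
  K : V n → V n
  K y = inverse b₁ (L₃ (inverse b₂ y))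
  K-linear : IsLinear K
  K-linear = linear-∘ (linear-inverse b₁ lin₁) (linear-∘ lin₃ (linear-inverse b₂ lin₂))
  H+K-bijective : Bijective (λ y → H y ⊕ K y)
  H+K-bijective = ea-addend-bijective lin₁ b₁ A₁≗ lin₂ b₂ A₂≗ lin₃ bP
                    (λ x → trans (cong (_ ⊕_) (sym (A₃≗ x))) (P≗ x))
  K-zero : IsZeroMap K
  K-zero = zero-stable K λ K≢0 → noAddend (K , K-linear , K≢0 , H+K-bijective)
  -- L₃ = L₁ ∘ K ∘ L₂ vanishes, so A₃ is the constant c₃
  A₃-constant : ∀ x → A₃ x ≡ c₃
  A₃-constant x = begin
    A₃ x                                   ≡⟨ A₃≗ x ⟩
    L₃ x ⊕ c₃                              ≡⟨ cong (λ t → L₃ t ⊕ c₃) (inverseˡ b₂ x) ⟨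
    L₃ (inverse b₂ (L₂ x)) ⊕ c₃            ≡⟨ cong (_⊕ c₃) (inverseʳ b₁ _) ⟨
    L₁ (K (L₂ x)) ⊕ c₃                     ≡⟨ cong (λ t → L₁ t ⊕ c₃) (K-zero (L₂ x)) ⟩
    L₁ 𝟎 ⊕ c₃                              ≡⟨ cong (_⊕ c₃) (linear-𝟎 lin₁) ⟩
    𝟎 ⊕ c₃                                 ≡⟨ ⊕-identityˡ c₃ ⟩
    c₃                                     ∎
    where open ≡-Reasoning
  affine : ∀ x → A₁ (H (A₂ x)) ⊕ c₃ ≡ P x
  affine x = trans (cong (_ ⊕_) (sym (A₃-constant x))) (P≗ x)

-- affine equivalence reflects bijectivity: H = A₁⁻¹ ∘ P ∘ A₂⁻¹
affine-reflects-bijective : {H P : V n → V n} → AffEquiv H P → Bijective P → Bijective H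
affine-reflects-bijective {H = H} {P} (A₁ , A₂ , (_ , b₁) , (_ , b₂) , P≗) bP =
  bijective-≗ (∘-bijective (inverse-bijective b₁) (∘-bijective bP (inverse-bijective b₂))) H≗
  where
  H≗ : ∀ z → inverse b₁ (P (inverse b₂ z)) ≡ H z
  H≗ z = trans (cong (inverse b₁) (trans (sym (P≗ _)) (cong (A₁ ∘ H) (inverseʳ b₂ z))))
               (inverseˡ b₁ (H z))

NoLinearCombination : (F : V n → V n) → Set
NoLinearCombination {n} F = ¬ Σ (V n → V n) λ L₁ → Σ (V n → V n) λ L₂ →
  IsLinear L₁ × IsLinear L₂ × ¬ IsZeroMap L₁ × ¬ IsZeroMap L₂ × Bijective (λ x → L₁ (F x) ⊕ L₂ x)

-- taking L₁ = id, the hypothesis of (b) implies that of (a)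
combination⇒addend : 1 ≤ n → {F : V n → V n} → NoLinearCombination F → NoLinearAddend F
combination⇒addend 1≤n noComb (L , lin , L≢0 , bij) =
  noComb (id , L , (λ _ _ → refl) , lin , id-nonzero 1≤n , L≢0 , bij)

-- and also that of (a) for F⁻¹, since (F⁻¹ + L) ∘ F = id + L ∘ F
combination⇒inverse-addend : 1 ≤ n → {F Fi : V n → V n} → IsInverse Fi F →
                             NoLinearCombination F → NoLinearAddend Fi
combination⇒inverse-addend 1≤n {F} inv@(left , _) noComb (L , lin , L≢0 , bij) =
  noComb (L , id , lin , (λ _ _ → refl) , L≢0 , id-nonzero 1≤n ,
          bijective-≗ (∘-bijective bij (inverse⇒bijective (swap inv)))
                      (λ x → trans (cong (_⊕ L (F x)) (left x)) (⊕-comm x (L (F x)))))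

-- A transformation of graphs: the linear map (x, y) ↦ (α x + β y, γ x + δ y) is
-- injective and, followed by the translation by (a, b), maps the graph of F
-- onto that of G; the first coordinate is then a parametrisation of V n.
record GraphTransform {n : ℕ} (F G : V n → V n) : Set where
  field
    α β γ δ : V n → V n
    a b : V n
    α-linear : IsLinear α
    β-linear : IsLinear β
    γ-linear : IsLinear γ
    δ-linear : IsLinear δ
    𝓛-injective : ∀ {x y x′ y′} → α x ⊕ β y ≡ α x′ ⊕ β y′ → γ x ⊕ δ y ≡ γ x′ ⊕ δ y′ →
                  x ≡ x′ × y ≡ y′
    abscissa-bijective : Bijective (λ x → α x ⊕ β (F x) ⊕ a)
    on-graph : ∀ x → G (α x ⊕ β (F x) ⊕ a) ≡ γ x ⊕ δ (F x) ⊕ b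

-- a CCZ-equivalence is a graph transformation: the abscissa is surjective
-- since every point of the graph of G is hit, and injective since 𝓛 is
ccz⇒graphTransform : {F G : V n → V n} → CCZEquiv F G → GraphTransform F G
ccz⇒graphTransform {F = F} {G}
  (α , β , γ , δ , a , b , lα , lβ , lγ , lδ , (𝓛-inj , _) , fwd , bwd) =
  record { α-linear = lα ; β-linear = lβ ; γ-linear = lγ ; δ-linear = lδ
         ; 𝓛-injective = 𝓛-injective
         ; abscissa-bijective = bijective abscissa-injective abscissa-surjective
         ; on-graph = on-graph }
  where
  𝓛-injective : ∀ {x y x′ y′} → α x ⊕ β y ≡ α x′ ⊕ β y′ → γ x ⊕ δ y ≡ γ x′ ⊕ δ y′ →
                x ≡ x′ × y ≡ y′
  𝓛-injective e₁ e₂ = ,-injective (𝓛-inj (cong₂ _,_ e₁ e₂))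
  on-graph : ∀ x → G (α x ⊕ β (F x) ⊕ a) ≡ γ x ⊕ δ (F x) ⊕ b
  on-graph x with _ , e ← fwd (x , F x) (x , refl) with e₁ , e₂ ← ,-injective e =
    trans (cong G e₁) (sym e₂)
  abscissa-injective : Injective _≡_ _≡_ (λ x → α x ⊕ β (F x) ⊕ a)
  abscissa-injective {x} {y} e =
    proj₁ (𝓛-injective (⊕-injectiveʳ a e)
                       (⊕-injectiveʳ b (trans (sym (on-graph x)) (trans (cong G e) (on-graph y)))))
  abscissa-surjective : StrictlySurjective _≡_ (λ x → α x ⊕ β (F x) ⊕ a)
  abscissa-surjective u with _ , (x , refl) , e ← bwd (u , G u) (u , refl) =
    x , proj₁ (,-injective e)

-- An explicit EA-equivalence read off a graph relation with invertible α and δ: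
-- for x = α⁻¹ (y + a) one has G y = (δ (F x) + b) + γ x.
graph-relation⇒ea : {F G α γ δ : V n → V n} {a b : V n} →
  IsLinear α → IsLinear γ → IsLinear δ → (bα : Bijective α) → Bijective δ →
  (∀ x → G (α x ⊕ a) ≡ γ x ⊕ δ (F x) ⊕ b) → EAEquiv F G
graph-relation⇒ea {n} {F} {G} {α} {γ} {δ} {a} {b} lα lγ lδ bα bδ rel =
  A₁ , A₂ , (λ y → γ (A₂ y)) ,
  affine-permutation lδ bδ b A₁ (λ _ → refl) ,
  (translated-linear lα⁻¹ a , ∘-bijective (inverse-bijective bα) (translation-bijective a)) ,
  translated-linear (linear-∘ lγ lα⁻¹) a ,
  relation
  where
  lα⁻¹ : IsLinear (inverse bα)
  lα⁻¹ = linear-inverse bα lα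
  A₁ A₂ : V n → V n
  A₁ z = δ z ⊕ b
  A₂ y = inverse bα (y ⊕ a)
  relation : ∀ y → A₁ (F (A₂ y)) ⊕ γ (A₂ y) ≡ G y
  relation y = begin
    (δ (F x) ⊕ b) ⊕ γ x  ≡⟨ ⊕.xy∙z≈zx∙y _ _ _ ⟩
    γ x ⊕ δ (F x) ⊕ b    ≡⟨ rel x ⟨
    G (α x ⊕ a)          ≡⟨ cong (λ t → G (t ⊕ a)) (inverseʳ bα _) ⟩
    G (y ⊕ a ⊕ a)        ≡⟨ cong G (⊕-cancel y a) ⟩
    G y                  ∎
    where
    open ≡-Reasoning
    x = A₂ y

module _ {F G : V n → V n} (T : GraphTransform F G) where
  open GraphTransform T

  -- Exchanging the coordinates: the graph of F⁻¹ is the mirror image of that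
  -- of F, so T induces a transformation with blocks (β, α, δ, γ).
  mirror : {Fi : V n → V n} → IsInverse Fi F → GraphTransform Fi G
  mirror {Fi} inv@(_ , right) = record
    { α = β ; β = α ; γ = δ ; δ = γ ; a = a ; b = b
    ; α-linear = β-linear ; β-linear = α-linear ; γ-linear = δ-linear ; δ-linear = γ-linear
    ; 𝓛-injective = λ e₁ e₂ → swap (𝓛-injective (flip e₁) (flip e₂))
    ; abscissa-bijective = bijective-≗ (∘-bijective abscissa-bijective (inverse⇒bijective inv)) mirrored
    ; on-graph = λ u → trans (cong G (sym (mirrored u))) (trans (on-graph (Fi u)) (mirror-ordinate u)) }
    where
    flip : ∀ {x y x′ y′ : V n} → x ⊕ y ≡ x′ ⊕ y′ → y ⊕ x ≡ y′ ⊕ x′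
    flip {x} {y} {x′} {y′} e = trans (⊕-comm y x) (trans e (⊕-comm x′ y′))
    mirrored : ∀ u → α (Fi u) ⊕ β (F (Fi u)) ⊕ a ≡ β u ⊕ α (Fi u) ⊕ a
    mirrored u = cong (_⊕ a) (trans (cong (λ t → α (Fi u) ⊕ β t) (right u)) (⊕-comm _ _))
    mirror-ordinate : ∀ u → γ (Fi u) ⊕ δ (F (Fi u)) ⊕ b ≡ δ u ⊕ γ (Fi u) ⊕ b
    mirror-ordinate u = cong (_⊕ b) (trans (cong (λ t → γ (Fi u) ⊕ δ t) (right u)) (⊕-comm _ _))

  -- when β = 0 the abscissa is α + a, and δ is injective because 𝓛 is:
  -- the relation on the graph is then an EA-equivalence of F and G
  triangular⇒ea : IsZeroMap β → EAEquiv F G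
  triangular⇒ea β≡0 = graph-relation⇒ea α-linear γ-linear δ-linear α-bijective δ-bijective relation
    where
    drop : ∀ x → α x ⊕ β (F x) ≡ α x
    drop x = trans (cong (α x ⊕_) (β≡0 (F x))) (⊕-identityʳ (α x))
    α-bijective : Bijective α
    α-bijective = bijective-≗ (∘-bijective (translation-bijective a) abscissa-bijective)
                              (λ x → trans (⊕-cancel _ a) (drop x))
    δ-bijective : Bijective δ
    δ-bijective = injective⇒bijective λ {y} {y′} e →
      proj₂ (𝓛-injective {𝟎} {y} {𝟎} {y′} (cong (α 𝟎 ⊕_) (trans (β≡0 y) (sym (β≡0 y′))))
                                            (cong (γ 𝟎 ⊕_) e))
    relation : ∀ x → G (α x ⊕ a) ≡ γ x ⊕ δ (F x) ⊕ b
    relation x = trans (cong (λ t → G (t ⊕ a)) (sym (drop x))) (on-graph x)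

  -- when α = 0 the abscissa is β ∘ F + a, so F is injective, hence a permutation
  antitriangular⇒bijective : IsZeroMap α → Bijective F
  antitriangular⇒bijective α≡0 = injective⇒bijective λ {x} {y} e →
    proj₁ abscissa-bijective (cong₂ (λ s t → s ⊕ β t ⊕ a) (trans (α≡0 x) (sym (α≡0 y))) e)

-- Since β ∘ F + α is a permutation, the hypothesis of (b) forces β = 0 or
-- α = 0; the second case is the first one for F⁻¹ after mirroring.
graphTransform⇒ea-or-inverse : {F G : V n → V n} → NoLinearCombination F → GraphTransform F G →
  EAEquiv F G ⊎ Σ (V n → V n) λ F⁻¹ → IsInverse F⁻¹ F × EAEquiv F⁻¹ G
graphTransform⇒ea-or-inverse {F = F} noComb T with isZeroMap? (GraphTransform.β T)
... | yes β≡0 = inj₁ (triangular⇒ea T β≡0)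
... | no β≢0 = inj₂ (inverse bF , inv , triangular⇒ea (mirror T inv) α≡0)
  where
  open GraphTransform T
  α≡0 : IsZeroMap α
  α≡0 = zero-stable α λ α≢0 → noComb (β , α , β-linear , α-linear , β≢0 , α≢0 ,
    bijective-≗ (∘-bijective (translation-bijective a) abscissa-bijective)
                (λ x → trans (⊕-cancel _ a) (⊕-comm _ _)))
  bF : Bijective F
  bF = antitriangular⇒bijective T α≡0
  inv : IsInverse (inverse bF) F
  inv = inverseˡ bF , inverseʳ bF

ccz⇒ea-or-inverse : {F G : V n → V n} → NoLinearCombination F → CCZEquiv F G →
  EAEquiv F G ⊎ Σ (V n → V n) λ F⁻¹ → IsInverse F⁻¹ F × EAEquiv F⁻¹ G
ccz⇒ea-or-inverse noComb = graphTransform⇒ea-or-inverse noComb ∘ ccz⇒graphTransform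

-- Part (b), second claim: a permutation CCZ-equivalent to F is EA-equivalent
-- to F or to F⁻¹, and part (a) applies to both
ccz⇒affine-or-inverse : 1 ≤ n → {F P : V n → V n} →
  NoLinearCombination F → Bijective P → CCZEquiv F P →
  AffEquiv F P ⊎ Σ (V n → V n) λ F⁻¹ → IsInverse F⁻¹ F × AffEquiv F⁻¹ P
ccz⇒affine-or-inverse 1≤n noComb bP ccz with ccz⇒ea-or-inverse noComb ccz
... | inj₁ ea = inj₁ (ea⇒affine (combination⇒addend 1≤n noComb) bP ea)
... | inj₂ (Fi , inv , ea) =
  inj₂ (Fi , inv , ea⇒affine (combination⇒inverse-addend 1≤n inv noComb) bP ea)

proposition1 : (n : ℕ) → 1 ≤ n → (F : V n → V n) →
    ((¬ Σ (V n → V n) λ L → IsLinear L × ¬ IsZeroMap L × Bijective (λ x → F x ⊕ L x)) →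
      ((P : V n → V n) → Bijective P → EAEquiv F P → AffEquiv F P) ×
      (¬ Bijective F → (P : V n → V n) → Bijective P → ¬ EAEquiv F P))
  × ((¬ Σ (V n → V n) λ L₁ → Σ (V n → V n) λ L₂ →
          IsLinear L₁ × IsLinear L₂ × ¬ IsZeroMap L₁ × ¬ IsZeroMap L₂ ×
          Bijective (λ x → L₁ (F x) ⊕ L₂ x)) →
      ((G : V n → V n) → CCZEquiv F G →
          EAEquiv F G ⊎ Σ (V n → V n) λ F⁻¹ → IsInverse F⁻¹ F × EAEquiv F⁻¹ G) ×
      ((P : V n → V n) → Bijective P → CCZEquiv F P →
          AffEquiv F P ⊎ Σ (V n → V n) λ F⁻¹ → IsInverse F⁻¹ F × AffEquiv F⁻¹ P))
proposition1 n 1≤n F =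
  (λ noAddend →
     (λ P → ea⇒affine noAddend) ,
     (λ ¬bF P bP ea → ¬bF (affine-reflects-bijective (ea⇒affine noAddend bP ea) bP))) ,
  (λ noComb →
     (λ G → ccz⇒ea-or-inverse noComb) ,
     (λ P → ccz⇒affine-or-inverse 1≤n noComb))
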